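{- Let $q\ge5$ be prime, $q^*=(-1)^{(q-1)/2}q$ and $u_q(j)=(3^j-q^*(-1)^j)/4$ ($j\ge1$). Let $d>1$ and write $d=3^{\alpha}\delta$ with $\gcd(\delta,3)=1$. Then the sequence $(u_q(j))_{j\ge1}$ is eventually periodic modulo $d$, its period $\rho_q(d)$ satisfies $$\rho_q(d)=\begin{cases}\operatorname{ord}_{4\delta}(9) & \text{if } d=q \text{ and } \operatorname{ord}_q(3) \text{ is odd};\\ 2\operatorname{ord}_{4\delta}(9) & \text{otherwise},\end{cases}$$ and its pre-period equals $\max(1,\alpha)$.
   Context: A sequence $(v_j)$ is (eventually) periodic modulo $d$ if there are $n_0\ge1$, $k\ge1$ with $v_n\equiv v_{n+k}\pmod d$ for all $n\ge n_0$; the smallest such $k$ (valid for all $n\ge n_0$ for some $n_0$) is the period, and the minimal admissible $n_0$ is the pre-period. $\operatorname{ord}_m(a)$ denotes the multiplicative order of $a$ modulo $m$. -}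

module Defs where

open import Data.Nat as ℕ using (ℕ; _≤_; _∸_)
import Data.Nat.DivMod as ℕD
open import Data.Integer using (ℤ; +_; -_; _-_; _*_; _^_; _/_; -1ℤ; 1ℤ)
open import Data.Integer.Divisibility using (_∣_)
open import Data.Product using (_×_; Σ)

infix 4 _≡_[mod_]
_≡_[mod_] : ℤ → ℤ → ℕ → Set
a ≡ b [mod d ] = (+ d) ∣ (a - b)

qstar : ℕ → ℤ
qstar q = (-1ℤ ^ ((q ∸ 1) ℕD./ 2)) * (+ q)

-- u_q(j) = (3^j - q* (-1)^j) / 4   (exact division for odd q)
u : ℕ → ℕ → ℤ
u q j = ((+ 3) ^ j - qstar q * (-1ℤ ^ j)) / (+ 4)

IsOrd : ℕ → ℕ → ℕ → Set
IsOrd m a k = (1 ≤ k) × (((+ a) ^ k ≡ 1ℤ [mod m ])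
            × (∀ k′ → 1 ≤ k′ → (+ a) ^ k′ ≡ 1ℤ [mod m ] → k ≤ k′))

Admissible : (ℕ → ℤ) → ℕ → ℕ → ℕ → Set
Admissible v d n₀ k = (1 ≤ n₀) × (∀ n → n₀ ≤ n → v n ≡ v (n ℕ.+ k) [mod d ])

EventuallyPeriodic : (ℕ → ℤ) → ℕ → Set
EventuallyPeriodic v d = Σ ℕ λ n₀ → Σ ℕ λ k → (1 ≤ k) × Admissible v d n₀ k

IsPeriod : (ℕ → ℤ) → ℕ → ℕ → Set
IsPeriod v d k = (1 ≤ k) × (Σ ℕ (λ n₀ → Admissible v d n₀ k)
               × (∀ k′ n₀ → 1 ≤ k′ → Admissible v d n₀ k′ → k ≤ k′))

IsPrePeriod : (ℕ → ℤ) → ℕ → ℕ → ℕ → Set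
IsPrePeriod v d k n₀ = Admissible v d n₀ k × (∀ n₁ → Admissible v d n₁ k → n₀ ≤ n₁)

{-# OPTIONS --safe #-}
-- Put w j = 3^j − q*·(−1)^j = 4·u_q(j) (exact, as q* ≡ 1 mod 4). Then u_q(n) ≡ u_q(n+k) (mod d)
-- iff 4d divides Δ = w(n+k) − w(n) = 3^n·(3^k − 1) − q*·(−1)^n·((−1)^k − 1).
-- For even k = 2m ≥ 2, Δ = 3^n·(9^m − 1) with 3 ∤ 9^m − 1, so for d = 3^α·δ the shift k works
-- from n on iff α ≤ n and 9^m ≡ 1 (mod 4δ).
-- For odd k, Δ ≡ 4 (mod 8) forces d to be odd, and 3·Δ(n) − Δ(n+1) = 8·q*·(−1)^n forces d ∣ q,
-- i.e. d = q; the shift then works from n = 1 on iff 3^k ≡ 1 (mod q).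
-- So the period is 2·ord_{4δ}(9) with pre-period max(1, α), except when d = q and ord_q(3) is odd:
-- then ord_{4q}(9) = ord_q(3) is itself an admissible odd shift.
module Submission where

open import Defs
open import Data.Nat using (ℕ; _*_; _^_; _<_; _≤_; _⊔_; _%_)
open import Data.Nat.Divisibility using (_∣_)
open import Data.Nat.Primality using (Prime)
open import Data.Product using (_×_)
open import Relation.Binary.PropositionalEquality using (_≡_)
open import Relation.Nullary using (¬_)

open import Data.Nat as ℕ using (zero; suc; z≤n; s≤s; NonZero)
import Data.Nat.Properties as ℕP
import Data.Nat.Divisibility as ℕD
import Data.Nat.DivMod as ℕM
import Data.Nat.Primality as ℕPr
open import Data.Nat.Coprimality as ℕC using (Coprime)
open import Data.Integer as ℤ using (ℤ; +_; -_; _+_; _-_; 1ℤ; -1ℤ; 0ℤ; ∣_∣)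
  renaming (_*_ to _·_; _^_ to _^ᶻ_)
import Data.Integer.Properties as ℤP
import Data.Integer.DivMod as ℤM
open import Data.Integer.Divisibility.Signed as ℤS using (divides) renaming (_∣_ to _∣ᶻ_)
open import Data.Integer.Tactic.RingSolver using (solve-∀)
import Data.Nat.Tactic.RingSolver as ℕS
open import Data.Fin using (Fin; toℕ)
import Data.Fin.Properties as FinP
open import Data.Product using (∃; _,_; proj₁; proj₂)
open import Data.Sum using (inj₁; inj₂)
open import Relation.Binary.PropositionalEquality using (refl; sym; trans; cong; cong₂; subst; subst₂; module ≡-Reasoning)
open import Relation.Nullary using (contradiction)
open import Relation.Nullary.Decidable using (from-yes; from-no)

data Parity : ℕ → Set where
  even : ∀ m → Parity (2 * m)
  odd  : ∀ m → Parity (suc (2 * m))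

parity : ∀ n → Parity n
parity zero = even 0
parity (suc n) with parity n
... | even m = odd m
... | odd m  = subst Parity (ℕP.*-suc 2 m) (even (suc m))

¬2∣odd : ∀ m → ¬ 2 ∣ suc (2 * m)
¬2∣odd m 2∣odd = contradiction (ℕD.∣1⇒≡1 2∣1) λ ()
  where
  2∣1 : 2 ∣ 1
  2∣1 = ℕD.∣m+n∣m⇒∣n (subst (2 ∣_) (ℕP.+-comm 1 (2 * m)) 2∣odd) (ℕD.m∣m*n m)

%2≡1⇒¬2∣ : ∀ n → n % 2 ≡ 1 → ¬ 2 ∣ n
%2≡1⇒¬2∣ n n%2≡1 2∣n = ℕP.0≢1+n (trans (sym (ℕD.n∣m⇒m%n≡0 n 2 2∣n)) n%2≡1)

¬2∣⇒%2≡1 : ∀ n → ¬ 2 ∣ n → n % 2 ≡ 1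
¬2∣⇒%2≡1 n ¬2∣n with n % 2 in eq | ℕM.m%n<n n 2
... | 0           | _ = contradiction (ℕD.m%n≡0⇒n∣m n 2 eq) ¬2∣n
... | 1           | _ = refl
... | suc (suc _) | s≤s (s≤s ())

m≤n⇒a^m∣a^n : ∀ a {m n} → m ≤ n → a ^ m ∣ a ^ n
m≤n⇒a^m∣a^n a {m} {n} m≤n = subst (a ^ m ∣_) (trans (sym (ℕP.^-distribˡ-+-* a m (n ℕ.∸ m))) (cong (a ^_) (ℕP.m+[n∸m]≡n m≤n)))
  (ℕD.m∣m*n (a ^ (n ℕ.∸ m)))

∣∧<⇒≡0 : ∀ {m r} → m ∣ r → r < m → r ≡ 0
∣∧<⇒≡0 {r = zero}  _   _   = refl
∣∧<⇒≡0 {r = suc _} m∣r r<m = contradiction m∣r (ℕD.>⇒∤ r<m)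

<∧least⇒≡0 : ∀ {r s} → r < s → (1 ≤ r → s ≤ r) → r ≡ 0
<∧least⇒≡0 {zero}  _   _     = refl
<∧least⇒≡0 {suc _} r<s least = contradiction (least (s≤s z≤n)) (ℕP.<⇒≱ r<s)

^∣^*⇒≤ : ∀ {p m} .{{_ : NonZero p}} → ¬ p ∣ m → ∀ α n → p ^ α ∣ p ^ n * m → α ≤ n
^∣^*⇒≤ p∤m zero n _ = z≤n
^∣^*⇒≤ {p} {m} p∤m (suc α) zero p^α∣m =
  contradiction (ℕD.∣-trans (ℕD.m∣m*n (p ^ α)) (subst (p ^ suc α ∣_) (ℕP.*-identityˡ m) p^α∣m)) p∤m
^∣^*⇒≤ {p} {m} p∤m (suc α) (suc n) p^α∣p^n*m =
  s≤s (^∣^*⇒≤ p∤m α n (ℕD.*-cancelˡ-∣ p (subst (p * p ^ α ∣_) (ℕP.*-assoc p (p ^ n) m) p^α∣p^n*m)))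

coprime-∣^*⇒∣ : ∀ {m a o} → Coprime m a → ∀ n → m ∣ a ^ n * o → m ∣ o
coprime-∣^*⇒∣ {m} {o = o} _ zero m∣o = subst (m ∣_) (ℕP.*-identityˡ o) m∣o
coprime-∣^*⇒∣ {m} {a} {o} cop (suc n) m∣a^n*o =
  coprime-∣^*⇒∣ cop n (ℕC.coprime-divisor cop (subst (m ∣_) (ℕP.*-assoc a (a ^ n) o) m∣a^n*o))

coprime-∣∧∣⇒*∣ : ∀ {a b n} → Coprime a b → a ∣ n → b ∣ n → a * b ∣ n
coprime-∣∧∣⇒*∣ {a} {b} cop (ℕD.divides t refl) b∣t*a = subst (a * b ∣_) (ℕP.*-comm a t)
  (ℕD.*-monoʳ-∣ a (ℕC.coprime-divisor (ℕC.sym cop) (subst (b ∣_) (ℕP.*-comm t a) b∣t*a)))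

∤⇒coprime : ∀ {p m} → Prime p → ¬ p ∣ m → Coprime m p
∤⇒coprime pp p∤m {e} (e∣m , e∣p) with ℕPr.prime⇒irreducible pp e∣p
... | inj₁ e≡1 = e≡1
... | inj₂ refl = contradiction e∣m p∤m

∣prime⇒≡ : ∀ {d p} → Prime p → 1 < d → d ∣ p → d ≡ p
∣prime⇒≡ pp 1<d d∣p with ℕPr.prime⇒irreducible pp d∣p
... | inj₁ refl = contradiction 1<d (ℕP.<-irrefl refl)
... | inj₂ d≡p = d≡p

prime[3] : Prime 3
prime[3] = from-yes (ℕPr.prime? 3)

∣ᶻ-respʳ : ∀ {k x y} → k ∣ᶻ x → x ≡ y → k ∣ᶻ y
∣ᶻ-respʳ k∣x refl = k∣x

pos-^ : ∀ a n → (+ a) ^ᶻ n ≡ + (a ^ n)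
pos-^ a zero    = refl
pos-^ a (suc n) = trans (cong (+ a ·_) (pos-^ a n)) (sym (ℤP.pos-* a (a ^ n)))

∣a^n·x∣≡a^n*∣x∣ : ∀ a n x → ∣ (+ a) ^ᶻ n · x ∣ ≡ a ^ n * ∣ x ∣
∣a^n·x∣≡a^n*∣x∣ a n x = trans (ℤP.abs-* ((+ a) ^ᶻ n) x) (cong (λ y → ∣ y ∣ * ∣ x ∣) (pos-^ a n))

[x/n]*n≡x : ∀ x n .{{_ : ℤ.NonZero n}} → n ∣ᶻ x → (x ℤ./ n) · n ≡ x
[x/n]*n≡x x n n∣x = begin
  (x ℤ./ n) · n                ≡⟨ sym (ℤP.+-identityˡ ((x ℤ./ n) · n)) ⟩
  + 0 + (x ℤ./ n) · n          ≡⟨ cong (λ r → + r + (x ℤ./ n) · n) (sym x%n≡0) ⟩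
  + (x ℤ.% n) + (x ℤ./ n) · n  ≡⟨ sym (ℤM.a≡a%n+[a/n]*n x n) ⟩
  x                            ∎
  where
  open ≡-Reasoning
  shift : ∀ r y → r ≡ (r + y) - y
  shift = solve-∀
  remainder : + (x ℤ.% n) ≡ x - (x ℤ./ n) · n
  remainder = trans (shift (+ (x ℤ.% n)) ((x ℤ./ n) · n)) (cong (_- (x ℤ./ n) · n) (sym (ℤM.a≡a%n+[a/n]*n x n)))
  n∣x%n : n ∣ᶻ + (x ℤ.% n)
  n∣x%n = ∣ᶻ-respʳ (ℤS.∣m∣n⇒∣m-n n∣x (ℤS.∣n⇒∣m*n (x ℤ./ n) (ℤS.∣-refl {n}))) (sym remainder)
  x%n≡0 : x ℤ.% n ≡ 0
  x%n≡0 = ∣∧<⇒≡0 (ℤS.∣⇒∣ᵤ n∣x%n) (ℤM.n%d<d x n)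

%≡%⇒∣- : ∀ x y {N} .{{_ : NonZero N}} → x % N ≡ y % N → + N ∣ᶻ + x - + y
%≡%⇒∣- x y {N} x%N≡y%N = divides (a - b) (begin
  + x - + y                                  ≡⟨ cong₂ _-_ (split x) (split y) ⟩
  (+ (x % N) + a · + N) - (+ (y % N) + b · + N) ≡⟨ cong (λ r → (+ r + a · + N) - (+ (y % N) + b · + N)) x%N≡y%N ⟩
  (+ (y % N) + a · + N) - (+ (y % N) + b · + N) ≡⟨ cancel (+ (y % N)) a b (+ N) ⟩
  (a - b) · + N                              ∎)
  where
  open ≡-Reasoning
  a b : ℤ
  a = + (x ℕ./ N)
  b = + (y ℕ./ N)
  split : ∀ n → + n ≡ + (n % N) + + (n ℕ./ N) · + N
  split n = trans (cong +_ (ℕM.m≡m%n+[m/n]*n n N))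
    (trans (ℤP.pos-+ (n % N) _) (cong (_+_ (+ (n % N))) (ℤP.pos-* (n ℕ./ N) N)))
  cancel : ∀ r a b n → (r + a · n) - (r + b · n) ≡ (a - b) · n
  cancel = solve-∀

^-≡1 : ∀ {m x} n → m ∣ᶻ x - 1ℤ → m ∣ᶻ x ^ᶻ n - 1ℤ
^-≡1 zero _ = divides 0ℤ refl
^-≡1 {x = x} (suc n) m∣x-1 =
  ∣ᶻ-respʳ (ℤS.∣m∣n⇒∣m+n (ℤS.∣n⇒∣m*n x (^-≡1 n m∣x-1)) m∣x-1) (telescope x (x ^ᶻ n))
  where
  telescope : ∀ x y → x · (y - 1ℤ) + (x - 1ℤ) ≡ x · y - 1ℤ
  telescope = solve-∀

ord∣ : ∀ {m a s k} → IsOrd m a s → (+ a) ^ᶻ k ≡ 1ℤ [mod m ] → s ∣ k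
ord∣ {m} {a} {s@(suc _)} {k} (_ , a^s≡1 , least) a^k≡1 =
  ℕD.m%n≡0⇒n∣m k s (<∧least⇒≡0 (ℕM.m%n<n k s) λ 1≤r → least r 1≤r (ℤS.∣⇒∣ᵤ a^r≡1))
  where
  open ≡-Reasoning
  A : ℤ
  A = + a
  r t : ℕ
  r = k % s
  t = k ℕ./ s
  a^k≡a^r·[a^s]^t : A ^ᶻ k ≡ A ^ᶻ r · (A ^ᶻ s) ^ᶻ t
  a^k≡a^r·[a^s]^t = begin
    A ^ᶻ k                  ≡⟨ cong (A ^ᶻ_) (ℕM.m≡m%n+[m/n]*n k s) ⟩
    A ^ᶻ (r ℕ.+ t * s)      ≡⟨ ℤP.^-distribˡ-+-* A r (t * s) ⟩
    A ^ᶻ r · A ^ᶻ (t * s)   ≡⟨ cong (λ e → A ^ᶻ r · A ^ᶻ e) (ℕP.*-comm t s) ⟩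
    A ^ᶻ r · A ^ᶻ (s * t)   ≡⟨ cong (A ^ᶻ r ·_) (sym (ℤP.^-*-assoc A s t)) ⟩
    A ^ᶻ r · (A ^ᶻ s) ^ᶻ t  ∎
  peel : ∀ p y → (p · y - 1ℤ) - p · (y - 1ℤ) ≡ p - 1ℤ
  peel = solve-∀
  a^r≡1 : + m ∣ᶻ A ^ᶻ r - 1ℤ
  a^r≡1 = ∣ᶻ-respʳ
    (ℤS.∣m∣n⇒∣m-n (∣ᶻ-respʳ (ℤS.∣ᵤ⇒∣ a^k≡1) (cong (_- 1ℤ) a^k≡a^r·[a^s]^t))
                  (ℤS.∣n⇒∣m*n (A ^ᶻ r) (^-≡1 t (ℤS.∣ᵤ⇒∣ a^s≡1))))
    (peel (A ^ᶻ r) ((A ^ᶻ s) ^ᶻ t))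

coprime⇒pow≡1 : ∀ N .{{_ : NonZero N}} {a} → Coprime N a → ∃ λ e → (+ a) ^ᶻ suc e ≡ 1ℤ [mod N ]
coprime⇒pow≡1 N {a} cop
  with i , j , i<j , fi≡fj ← FinP.pigeonhole (ℕP.n<1+n N) (λ (i : Fin (suc N)) → (a ^ toℕ i) ℕM.mod N)
  with e , i+1+e≡j ← ℕP.m≤n⇒∃[o]m+o≡n i<j
  = e , coprime-∣^*⇒∣ cop (toℕ i) (subst (N ∣_) (∣a^n·x∣≡a^n*∣x∣ a (toℕ i) Z) (ℤS.∣⇒∣ᵤ N∣a^i·Z))
  where
  open ≡-Reasoning
  A Z : ℤ
  A = + a
  Z = A ^ᶻ suc e - 1ℤ
  factor : ∀ p y → p · y - p ≡ p · (y - 1ℤ)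
  factor = solve-∀
  a^j-a^i : + (a ^ toℕ j) - + (a ^ toℕ i) ≡ A ^ᶻ toℕ i · Z
  a^j-a^i = begin
    + (a ^ toℕ j) - + (a ^ toℕ i)                   ≡⟨ cong₂ _-_ (sym (pos-^ a (toℕ j))) (sym (pos-^ a (toℕ i))) ⟩
    A ^ᶻ toℕ j - A ^ᶻ toℕ i                         ≡⟨ cong (λ n → A ^ᶻ n - A ^ᶻ toℕ i) (sym (trans (ℕP.+-suc (toℕ i) e) i+1+e≡j)) ⟩
    A ^ᶻ (toℕ i ℕ.+ suc e) - A ^ᶻ toℕ i             ≡⟨ cong (_- A ^ᶻ toℕ i) (ℤP.^-distribˡ-+-* A (toℕ i) (suc e)) ⟩
    A ^ᶻ toℕ i · A ^ᶻ suc e - A ^ᶻ toℕ i            ≡⟨ factor (A ^ᶻ toℕ i) (A ^ᶻ suc e) ⟩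
    A ^ᶻ toℕ i · Z                                  ∎
  a^i%N≡a^j%N : a ^ toℕ j % N ≡ a ^ toℕ i % N
  a^i%N≡a^j%N = trans (sym (FinP.toℕ-fromℕ< _)) (trans (cong toℕ (sym fi≡fj)) (FinP.toℕ-fromℕ< _))
  N∣a^i·Z : + N ∣ᶻ A ^ᶻ toℕ i · Z
  N∣a^i·Z = ∣ᶻ-respʳ (%≡%⇒∣- (a ^ toℕ j) (a ^ toℕ i) a^i%N≡a^j%N) a^j-a^i

3^[2m]≡9^m : ∀ m → (+ 3) ^ᶻ (2 * m) ≡ (+ 9) ^ᶻ m
3^[2m]≡9^m m = sym (ℤP.^-*-assoc (+ 3) 2 m)

3^s≡1⇒9^s≡1 : ∀ {m} s → m ∣ᶻ (+ 3) ^ᶻ s - 1ℤ → m ∣ᶻ (+ 9) ^ᶻ s - 1ℤ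
3^s≡1⇒9^s≡1 s m∣3^s-1 = ∣ᶻ-respʳ (ℤS.∣m⇒∣m*n ((+ 3) ^ᶻ s + 1ℤ) m∣3^s-1) (begin
  ((+ 3) ^ᶻ s - 1ℤ) · ((+ 3) ^ᶻ s + 1ℤ) ≡⟨ difference-of-squares ((+ 3) ^ᶻ s) ⟩
  ((+ 3) ^ᶻ s) ^ᶻ 2 - 1ℤ                ≡⟨ cong (_- 1ℤ) (ℤP.^-*-assoc (+ 3) s 2) ⟩
  (+ 3) ^ᶻ (s * 2) - 1ℤ                 ≡⟨ cong (λ e → (+ 3) ^ᶻ e - 1ℤ) (ℕP.*-comm s 2) ⟩
  (+ 3) ^ᶻ (2 * s) - 1ℤ                 ≡⟨ cong (_- 1ℤ) (3^[2m]≡9^m s) ⟩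
  (+ 9) ^ᶻ s - 1ℤ                       ∎)
  where
  open ≡-Reasoning
  difference-of-squares : ∀ x → (x - 1ℤ) · (x + 1ℤ) ≡ x · (x · 1ℤ) - 1ℤ
  difference-of-squares = solve-∀

[-1]^[2m]≡1 : ∀ m → -1ℤ ^ᶻ (2 * m) ≡ 1ℤ
[-1]^[2m]≡1 m = trans (sym (ℤP.^-*-assoc -1ℤ 2 m)) (ℤP.^-zeroˡ m)

∣[-1]^n∣≡1 : ∀ n → ∣ -1ℤ ^ᶻ n ∣ ≡ 1
∣[-1]^n∣≡1 zero    = refl
∣[-1]^n∣≡1 (suc n) = trans (ℤP.abs-* -1ℤ (-1ℤ ^ᶻ n)) (cong (1 *_) (∣[-1]^n∣≡1 n))

8∣9^m-1 : ∀ m → + 8 ∣ᶻ (+ 9) ^ᶻ m - 1ℤ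
8∣9^m-1 m = ^-≡1 m (ℤS.∣-refl {+ 8})

4∣3^n-[-1]^n : ∀ n → + 4 ∣ᶻ (+ 3) ^ᶻ n - -1ℤ ^ᶻ n
4∣3^n-[-1]^n zero    = divides 0ℤ refl
4∣3^n-[-1]^n (suc n) = ∣ᶻ-respʳ
  (ℤS.∣m∣n⇒∣m+n (ℤS.∣n⇒∣m*n (+ 3) (4∣3^n-[-1]^n n)) (ℤS.∣m⇒∣m*n (-1ℤ ^ᶻ n) (ℤS.∣-refl {+ 4})))
  (step ((+ 3) ^ᶻ n) (-1ℤ ^ᶻ n))
  where
  step : ∀ a s → + 3 · (a - s) + + 4 · s ≡ + 3 · a - -1ℤ · s
  step = solve-∀

4∣3^n+[-1]^n-2 : ∀ n → + 4 ∣ᶻ (+ 3) ^ᶻ n + -1ℤ ^ᶻ n - + 2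
4∣3^n+[-1]^n-2 zero    = divides 0ℤ refl
4∣3^n+[-1]^n-2 (suc n) = ∣ᶻ-respʳ
  (ℤS.∣m∣n⇒∣m+n (ℤS.∣n⇒∣m*n (+ 3) (4∣3^n+[-1]^n-2 n)) (ℤS.∣m⇒∣m*n (1ℤ - -1ℤ ^ᶻ n) (ℤS.∣-refl {+ 4})))
  (step ((+ 3) ^ᶻ n) (-1ℤ ^ᶻ n))
  where
  step : ∀ a s → + 3 · (a + s - + 2) + + 4 · (1ℤ - s) ≡ + 3 · a + -1ℤ · s - + 2
  step = solve-∀

¬3∣9^[1+m]-1 : ∀ m → ¬ 3 ∣ ∣ (+ 9) ^ᶻ suc m - 1ℤ ∣
¬3∣9^[1+m]-1 m 3∣9^[1+m]-1 = contradiction (ℕD.∣1⇒≡1 (ℤS.∣⇒∣ᵤ 3∣1)) λ ()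
  where
  3∣9^[1+m] : + 3 ∣ᶻ (+ 9) ^ᶻ suc m
  3∣9^[1+m] = ℤS.∣m⇒∣m*n ((+ 9) ^ᶻ m) (divides (+ 3) refl)
  3∣1 : + 3 ∣ᶻ 1ℤ
  3∣1 = ∣ᶻ-respʳ (ℤS.∣m∣n⇒∣m-n 3∣9^[1+m] (ℤS.∣ᵤ⇒∣ 3∣9^[1+m]-1)) (cancel ((+ 9) ^ᶻ suc m))
    where
    cancel : ∀ y → y - (y - 1ℤ) ≡ 1ℤ
    cancel = solve-∀

coprime[4δ,3] : ∀ {δ} → ¬ 3 ∣ δ → Coprime (4 * δ) 3
coprime[4δ,3] {δ} 3∤δ = ∤⇒coprime prime[3] 3∤4δ
  where
  3∤4δ : ¬ 3 ∣ 4 * δ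
  3∤4δ 3∣4δ with ℕPr.euclidsLemma 4 δ prime[3] 3∣4δ
  ... | inj₁ 3∣4 = from-no (3 ℕD.∣? 4) 3∣4
  ... | inj₂ 3∣δ = 3∤δ 3∣δ

module Sequence (c : ℤ) (4∣c-1 : + 4 ∣ᶻ c - 1ℤ) where

  w : ℕ → ℤ
  w j = (+ 3) ^ᶻ j - c · -1ℤ ^ᶻ j

  Δw : ℕ → ℕ → ℤ
  Δw n k = w (n ℕ.+ k) - w n

  Δw≡ : ∀ n k → Δw n k ≡ (+ 3) ^ᶻ n · ((+ 3) ^ᶻ k - 1ℤ) - c · -1ℤ ^ᶻ n · (-1ℤ ^ᶻ k - 1ℤ)
  Δw≡ n k = trans
    (cong₂ (λ a s → (a - c · s) - w n) (ℤP.^-distribˡ-+-* (+ 3) n k) (ℤP.^-distribˡ-+-* -1ℤ n k))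
    (regroup ((+ 3) ^ᶻ n) ((+ 3) ^ᶻ k) (-1ℤ ^ᶻ n) (-1ℤ ^ᶻ k) c)
    where
    regroup : ∀ a b s t c → (a · b - c · (s · t)) - (a - c · s) ≡ a · (b - 1ℤ) - c · s · (t - 1ℤ)
    regroup = solve-∀

  Δw-even : ∀ n m → Δw n (2 * m) ≡ (+ 3) ^ᶻ n · ((+ 9) ^ᶻ m - 1ℤ)
  Δw-even n m = trans (Δw≡ n (2 * m))
    (trans (cong₂ (λ x s → (+ 3) ^ᶻ n · (x - 1ℤ) - c · -1ℤ ^ᶻ n · (s - 1ℤ)) (3^[2m]≡9^m m) ([-1]^[2m]≡1 m))
           (drop ((+ 3) ^ᶻ n) ((+ 9) ^ᶻ m) (c · -1ℤ ^ᶻ n)))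
    where
    drop : ∀ a x y → a · (x - 1ℤ) - y · (1ℤ - 1ℤ) ≡ a · (x - 1ℤ)
    drop = solve-∀

  Δw-odd : ∀ n m → Δw n (suc (2 * m)) ≡ (+ 3) ^ᶻ n · ((+ 3) ^ᶻ suc (2 * m) - 1ℤ) + + 2 · c · -1ℤ ^ᶻ n
  Δw-odd n m = trans (Δw≡ n (suc (2 * m)))
    (trans (cong (λ s → (+ 3) ^ᶻ n · ((+ 3) ^ᶻ suc (2 * m) - 1ℤ) - c · -1ℤ ^ᶻ n · (-1ℤ · s - 1ℤ)) ([-1]^[2m]≡1 m))
           (flip ((+ 3) ^ᶻ n · ((+ 3) ^ᶻ suc (2 * m) - 1ℤ)) c (-1ℤ ^ᶻ n)))
    where
    flip : ∀ x c s → x - c · s · (-1ℤ · 1ℤ - 1ℤ) ≡ x + + 2 · c · s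
    flip = solve-∀

  4∣w : ∀ j → + 4 ∣ᶻ w j
  4∣w j = ∣ᶻ-respʳ (ℤS.∣m∣n⇒∣m-n (4∣3^n-[-1]^n j) (ℤS.∣m⇒∣m*n (-1ℤ ^ᶻ j) 4∣c-1))
    (regroup ((+ 3) ^ᶻ j) (-1ℤ ^ᶻ j) c)
    where
    regroup : ∀ a s c → (a - s) - (c - 1ℤ) · s ≡ a - c · s
    regroup = solve-∀

  -- For c = qstar q this is definitionally u q.
  v : ℕ → ℤ
  v j = w j ℤ./ + 4

  Δw≡-[Δv·4] : ∀ n k → Δw n k ≡ - ((v n - v (n ℕ.+ k)) · + 4)
  Δw≡-[Δv·4] n k = trans
    (cong₂ _-_ (sym ([x/n]*n≡x (w (n ℕ.+ k)) (+ 4) (4∣w (n ℕ.+ k)))) (sym ([x/n]*n≡x (w n) (+ 4) (4∣w n))))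
    (regroup (v n) (v (n ℕ.+ k)))
    where
    regroup : ∀ a b → b · + 4 - a · + 4 ≡ - ((a - b) · + 4)
    regroup = solve-∀

  ≡[mod]⇒4d∣Δw : ∀ d n k → v n ≡ v (n ℕ.+ k) [mod d ] → + (4 * d) ∣ᶻ Δw n k
  ≡[mod]⇒4d∣Δw d n k v≡ = ∣ᶻ-respʳ (ℤS.∣m⇒∣-m 4d∣Δv·4) (sym (Δw≡-[Δv·4] n k))
    where
    Δv : ℤ
    Δv = v n - v (n ℕ.+ k)
    4d∣Δv·4 : + (4 * d) ∣ᶻ Δv · + 4
    4d∣Δv·4 = subst (_∣ᶻ Δv · + 4) (trans (ℤP.*-comm (+ d) (+ 4)) (sym (ℤP.pos-* 4 d)))
      (ℤS.*-monoˡ-∣ (+ 4) (ℤS.∣ᵤ⇒∣ {+ d} {Δv} v≡))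

  4d∣Δw⇒≡[mod] : ∀ d n k → + (4 * d) ∣ᶻ Δw n k → v n ≡ v (n ℕ.+ k) [mod d ]
  4d∣Δw⇒≡[mod] d n k 4d∣Δw = ℤS.∣⇒∣ᵤ {+ d} {Δv} (ℤS.*-cancelʳ-∣ (+ 4) d·4∣Δv·4)
    where
    Δv : ℤ
    Δv = v n - v (n ℕ.+ k)
    d·4∣Δv·4 : + d · + 4 ∣ᶻ Δv · + 4
    d·4∣Δv·4 = subst (_∣ᶻ Δv · + 4) (trans (ℤP.pos-* 4 d) (ℤP.*-comm (+ 4) (+ d)))
      (∣ᶻ-respʳ (ℤS.∣m⇒∣-m (∣ᶻ-respʳ 4d∣Δw (Δw≡-[Δv·4] n k))) (ℤP.neg-involutive (Δv · + 4)))

  Δw-odd≡4[mod8] : ∀ n m → + 8 ∣ᶻ Δw n (suc (2 * m)) - + 4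
  Δw-odd≡4[mod8] n m = ∣ᶻ-respʳ (ℤS.∣m∣n⇒∣m+n (ℤS.∣m∣n⇒∣m+n 8∣A 8∣B) 8∣C) (begin
    (+ 3 · a) · (y - 1ℤ) + + 2 · (a + s - + 2) + + 2 · (s · (c - 1ℤ)) ≡⟨ regroup a y c s ⟩
    a · (+ 3 · y - 1ℤ) + + 2 · c · s - + 4                            ≡⟨ cong (λ x → a · (+ 3 · x - 1ℤ) + + 2 · c · s - + 4) (sym (3^[2m]≡9^m m)) ⟩
    a · ((+ 3) ^ᶻ suc (2 * m) - 1ℤ) + + 2 · c · s - + 4               ≡⟨ cong (_- + 4) (sym (Δw-odd n m)) ⟩
    Δw n (suc (2 * m)) - + 4                                          ∎)
    where
    open ≡-Reasoning
    a y s : ℤ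
    a = (+ 3) ^ᶻ n
    y = (+ 9) ^ᶻ m
    s = -1ℤ ^ᶻ n
    8∣A : + 8 ∣ᶻ (+ 3 · a) · (y - 1ℤ)
    8∣A = ℤS.∣n⇒∣m*n (+ 3 · a) (8∣9^m-1 m)
    8∣B : + 8 ∣ᶻ + 2 · (a + s - + 2)
    8∣B = ℤS.*-monoʳ-∣ (+ 2) (4∣3^n+[-1]^n-2 n)
    8∣C : + 8 ∣ᶻ + 2 · (s · (c - 1ℤ))
    8∣C = ℤS.*-monoʳ-∣ (+ 2) (ℤS.∣n⇒∣m*n s 4∣c-1)
    regroup : ∀ a y c s → (+ 3 · a) · (y - 1ℤ) + + 2 · (a + s - + 2) + + 2 · (s · (c - 1ℤ))
                          ≡ a · (+ 3 · y - 1ℤ) + + 2 · c · s - + 4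
    regroup = solve-∀

  ∣Δw-even∣≡ : ∀ n m → ∣ Δw n (2 * m) ∣ ≡ 3 ^ n * ∣ (+ 9) ^ᶻ m - 1ℤ ∣
  ∣Δw-even∣≡ n m = trans (cong ∣_∣ (Δw-even n m)) (∣a^n·x∣≡a^n*∣x∣ 3 n ((+ 9) ^ᶻ m - 1ℤ))

  even-shift⇐ : ∀ α δ n m → α ≤ n → (+ 9) ^ᶻ m ≡ 1ℤ [mod 4 * δ ] → + (4 * (3 ^ α * δ)) ∣ᶻ Δw n (2 * m)
  even-shift⇐ α δ n m α≤n 9^m≡1 = ℤS.∣ᵤ⇒∣ (subst₂ _∣_ (rearrange (3 ^ α) δ) (sym (∣Δw-even∣≡ n m))
    (ℕD.*-pres-∣ (m≤n⇒a^m∣a^n 3 α≤n) 9^m≡1))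
    where
    rearrange : ∀ x δ → x * (4 * δ) ≡ 4 * (x * δ)
    rearrange = ℕS.solve-∀

  even-shift⇒ : ∀ α δ n m → ¬ 3 ∣ δ → + (4 * (3 ^ α * δ)) ∣ᶻ Δw n (2 * suc m)
             → α ≤ n × ((+ 9) ^ᶻ suc m ≡ 1ℤ [mod 4 * δ ])
  even-shift⇒ α δ n m 3∤δ 4d∣Δw =
      ^∣^*⇒≤ (¬3∣9^[1+m]-1 m) α n (ℕD.∣-trans 3^α∣4d 4d∣3^n*X)
    , coprime-∣^*⇒∣ (coprime[4δ,3] 3∤δ) n (ℕD.∣-trans 4δ∣4d 4d∣3^n*X)
    where
    4d∣3^n*X : 4 * (3 ^ α * δ) ∣ 3 ^ n * ∣ (+ 9) ^ᶻ suc m - 1ℤ ∣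
    4d∣3^n*X = subst (_ ∣_) (∣Δw-even∣≡ n (suc m)) (ℤS.∣⇒∣ᵤ 4d∣Δw)
    3^α∣4d : 3 ^ α ∣ 4 * (3 ^ α * δ)
    3^α∣4d = ℕD.∣-trans (ℕD.m∣m*n δ) (ℕD.n∣m*n 4)
    4δ∣4d : 4 * δ ∣ 4 * (3 ^ α * δ)
    4δ∣4d = ℕD.*-monoʳ-∣ 4 (ℕD.n∣m*n (3 ^ α))

+[1+2x]≡1+2x : ∀ x → + suc (2 * x) ≡ 1ℤ + + 2 · + x
+[1+2x]≡1+2x x = trans (ℤP.pos-+ 1 (2 * x)) (cong (_+_ 1ℤ) (ℤP.pos-* 2 x))

qstar[1+2t] : ∀ t → qstar (suc (2 * t)) ≡ -1ℤ ^ᶻ t · (1ℤ + + 2 · + t)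
qstar[1+2t] t = cong₂ (λ e x → -1ℤ ^ᶻ e · x)
  (trans (cong (ℕ._/ 2) (ℕP.*-comm 2 t)) (ℕM.m*n/n≡m t 2)) (+[1+2x]≡1+2x t)

qstar≡1[mod4] : ∀ {q} → Prime q → 3 ≤ q → + 4 ∣ᶻ qstar q - 1ℤ
qstar≡1[mod4] {q} pq 3≤q with parity q
... | even t = contradiction (subst (3 ≤_) (sym (∣prime⇒≡ pq (s≤s (s≤s z≤n)) (ℕD.m∣m*n t))) 3≤q) (ℕP.<-irrefl refl)
... | odd t with parity t
...   | even m = divides (+ m) (begin
  qstar (suc (2 * (2 * m))) - 1ℤ                  ≡⟨ cong (_- 1ℤ) (qstar[1+2t] (2 * m)) ⟩
  -1ℤ ^ᶻ (2 * m) · (1ℤ + + 2 · + (2 * m)) - 1ℤ    ≡⟨ cong₂ (λ s x → s · (1ℤ + + 2 · x) - 1ℤ) ([-1]^[2m]≡1 m) (ℤP.pos-* 2 m) ⟩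
  1ℤ · (1ℤ + + 2 · (+ 2 · + m)) - 1ℤ              ≡⟨ simplify (+ m) ⟩
  + m · + 4                                        ∎)
  where
  open ≡-Reasoning
  simplify : ∀ x → 1ℤ · (1ℤ + + 2 · (+ 2 · x)) - 1ℤ ≡ x · + 4
  simplify = solve-∀
...   | odd m = divides (- (1ℤ + + m)) (begin
  qstar (suc (2 * suc (2 * m))) - 1ℤ                        ≡⟨ cong (_- 1ℤ) (qstar[1+2t] (suc (2 * m))) ⟩
  -1ℤ ^ᶻ suc (2 * m) · (1ℤ + + 2 · + suc (2 * m)) - 1ℤ      ≡⟨ cong₂ (λ s x → -1ℤ · s · (1ℤ + + 2 · x) - 1ℤ) ([-1]^[2m]≡1 m) (+[1+2x]≡1+2x m) ⟩
  -1ℤ · 1ℤ · (1ℤ + + 2 · (1ℤ + + 2 · + m)) - 1ℤ            ≡⟨ simplify (+ m) ⟩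
  - (1ℤ + + m) · + 4                                        ∎)
  where
  open ≡-Reasoning
  simplify : ∀ x → -1ℤ · 1ℤ · (1ℤ + + 2 · (1ℤ + + 2 · x)) - 1ℤ ≡ - (1ℤ + x) · + 4
  simplify = solve-∀

∣qstar∣≡q : ∀ q → ∣ qstar q ∣ ≡ q
∣qstar∣≡q q = trans (ℤP.abs-* (-1ℤ ^ᶻ ((q ℕ.∸ 1) ℕ./ 2)) (+ q))
                    (trans (cong (_* q) (∣[-1]^n∣≡1 ((q ℕ.∸ 1) ℕ./ 2))) (ℕP.*-identityˡ q))

q∣qstar : ∀ q → + q ∣ᶻ qstar q
q∣qstar q = divides (-1ℤ ^ᶻ ((q ℕ.∸ 1) ℕ./ 2)) refl

4∣∧q∣⇒4q∣ : ∀ {q x} → Prime q → 5 ≤ q → + 4 ∣ᶻ x → + q ∣ᶻ x → + (4 * q) ∣ᶻ x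
4∣∧q∣⇒4q∣ pq 5≤q 4∣x q∣x =
  ℤS.∣ᵤ⇒∣ (coprime-∣∧∣⇒*∣ (ℕC.sym (ℕC.prime⇒coprime pq 5≤q)) (ℤS.∣⇒∣ᵤ 4∣x) (ℤS.∣⇒∣ᵤ q∣x))

ord[4q]9≡ord[q]3 : ∀ {q r s} → Prime q → 5 ≤ q → IsOrd (4 * q) 9 r → IsOrd q 3 s → ¬ 2 ∣ s → r ≡ s
ord[4q]9≡ord[q]3 {q} {r} {s} pq 5≤q (1≤r , 9^r≡1 , least9) ord3@(1≤s , 3^s≡1 , _) 2∤s =
  ℕP.≤-antisym r≤s (ℕD.∣⇒≤ {{ℕ.>-nonZero 1≤r}} s∣r)
  where
  9^s≡1 : (+ 9) ^ᶻ s ≡ 1ℤ [mod 4 * q ]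
  9^s≡1 = ℤS.∣⇒∣ᵤ (4∣∧q∣⇒4q∣ pq 5≤q (ℤS.∣-trans (divides (+ 2) refl) (8∣9^m-1 s))
                                     (3^s≡1⇒9^s≡1 s (ℤS.∣ᵤ⇒∣ 3^s≡1)))
  r≤s : r ≤ s
  r≤s = least9 s 1≤s 9^s≡1
  3^[2r]≡1 : (+ 3) ^ᶻ (2 * r) ≡ 1ℤ [mod q ]
  3^[2r]≡1 = subst (λ x → q ∣ ∣ x - 1ℤ ∣) (sym (3^[2m]≡9^m r)) (ℕD.∣-trans (ℕD.n∣m*n 4) 9^r≡1)
  s∣r : s ∣ r
  s∣r = ℕC.coprime-divisor (∤⇒coprime ℕPr.prime[2] 2∤s) (ord∣ ord3 3^[2r]≡1)

module OddShift {q} (pq : Prime q) (5≤q : 5 ≤ q) where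

  3<q : 3 < q
  3<q = ℕP.≤-trans (s≤s (s≤s (s≤s (s≤s z≤n)))) 5≤q

  open Sequence (qstar q) (qstar≡1[mod4] pq (ℕP.<⇒≤ 3<q)) public

  c : ℤ
  c = qstar q

  3Δw-Δw′≡8c : ∀ n m → + 3 · Δw n (suc (2 * m)) - Δw (suc n) (suc (2 * m)) ≡ + 8 · c · -1ℤ ^ᶻ n
  3Δw-Δw′≡8c n m = trans (cong₂ (λ x y → + 3 · x - y) (Δw-odd n m) (Δw-odd (suc n) m))
    (cancel ((+ 3) ^ᶻ n) ((+ 3) ^ᶻ suc (2 * m) - 1ℤ) c (-1ℤ ^ᶻ n))
    where
    cancel : ∀ a b c s → + 3 · (a · b + + 2 · c · s) - ((+ 3 · a) · b + + 2 · c · (-1ℤ · s)) ≡ + 8 · c · s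
    cancel = solve-∀

  odd-shift⇒¬2∣d : ∀ d n m → + (4 * d) ∣ᶻ Δw n (suc (2 * m)) → ¬ 2 ∣ d
  odd-shift⇒¬2∣d d n m 4d∣Δw (ℕD.divides j refl) = from-no (8 ℕD.∣? 4) (ℤS.∣⇒∣ᵤ 8∣4)
    where
    8∣4d : 8 ∣ 4 * (j * 2)
    8∣4d = ℕD.divides j (rearrange j)
      where
      rearrange : ∀ j → 4 * (j * 2) ≡ j * 8
      rearrange = ℕS.solve-∀
    8∣Δw : + 8 ∣ᶻ Δw n (suc (2 * m))
    8∣Δw = ℤS.∣-trans (ℤS.∣ᵤ⇒∣ 8∣4d) 4d∣Δw
    8∣4 : + 8 ∣ᶻ + 4
    8∣4 = ∣ᶻ-respʳ (ℤS.∣m∣n⇒∣m-n 8∣Δw (Δw-odd≡4[mod8] n m)) (difference (Δw n (suc (2 * m))))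
      where
      difference : ∀ y → y - (y - + 4) ≡ + 4
      difference = solve-∀

  odd-shift⇒d≡q : ∀ d n m → 1 < d → + (4 * d) ∣ᶻ Δw n (suc (2 * m)) → + (4 * d) ∣ᶻ Δw (suc n) (suc (2 * m))
               → d ≡ q
  odd-shift⇒d≡q d n m 1<d 4d∣Δw 4d∣Δw′ = ∣prime⇒≡ pq 1<d
    (ℕC.coprime-divisor (∤⇒coprime ℕPr.prime[2] (odd-shift⇒¬2∣d d n m 4d∣Δw)) (ℕD.*-cancelˡ-∣ 4 4d∣8q))
    where
    ∣8c[-1]^n∣≡4[2q] : ∣ + 8 · c · -1ℤ ^ᶻ n ∣ ≡ 4 * (2 * q)
    ∣8c[-1]^n∣≡4[2q] = trans (ℤP.abs-* (+ 8 · c) (-1ℤ ^ᶻ n))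
      (trans (cong₂ _*_ (trans (ℤP.abs-* (+ 8) c) (cong (8 *_) (∣qstar∣≡q q))) (∣[-1]^n∣≡1 n)) (rearrange q))
      where
      rearrange : ∀ q → 8 * q * 1 ≡ 4 * (2 * q)
      rearrange = ℕS.solve-∀
    4d∣8q : 4 * d ∣ 4 * (2 * q)
    4d∣8q = subst (_ ∣_) ∣8c[-1]^n∣≡4[2q]
      (ℤS.∣⇒∣ᵤ (∣ᶻ-respʳ (ℤS.∣m∣n⇒∣m-n (ℤS.∣n⇒∣m*n (+ 3) 4d∣Δw) 4d∣Δw′) (3Δw-Δw′≡8c n m)))

  odd-shift⇒3^k≡1 : ∀ n m → + (4 * q) ∣ᶻ Δw n (suc (2 * m)) → (+ 3) ^ᶻ suc (2 * m) ≡ 1ℤ [mod q ]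
  odd-shift⇒3^k≡1 n m 4q∣Δw = coprime-∣^*⇒∣ (ℕC.prime⇒coprime pq 3<q) n
    (subst (q ∣_) (∣a^n·x∣≡a^n*∣x∣ 3 n A) (ℤS.∣⇒∣ᵤ q∣3^n·A))
    where
    A : ℤ
    A = (+ 3) ^ᶻ suc (2 * m) - 1ℤ
    q∣3^n·A : + q ∣ᶻ (+ 3) ^ᶻ n · A
    q∣3^n·A = ∣ᶻ-respʳ
      (ℤS.∣m∣n⇒∣m-n (∣ᶻ-respʳ (ℤS.∣-trans (divides (+ 4) (ℤP.pos-* 4 q)) 4q∣Δw) (Δw-odd n m))
                    (ℤS.∣m⇒∣m*n (-1ℤ ^ᶻ n) (ℤS.∣n⇒∣m*n (+ 2) (q∣qstar q))))
      (cancel ((+ 3) ^ᶻ n · A) c (-1ℤ ^ᶻ n))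
      where
      cancel : ∀ x c s → (x + + 2 · c · s) - + 2 · c · s ≡ x
      cancel = solve-∀

  odd-shift⇐ : ∀ n m → (+ 3) ^ᶻ suc (2 * m) ≡ 1ℤ [mod q ] → + (4 * q) ∣ᶻ Δw n (suc (2 * m))
  odd-shift⇐ n m 3^k≡1 = 4∣∧q∣⇒4q∣ pq 5≤q 4∣Δw q∣Δw
    where
    4∣Δw : + 4 ∣ᶻ Δw n (suc (2 * m))
    4∣Δw = ∣ᶻ-respʳ (ℤS.∣m∣n⇒∣m+n (ℤS.∣-trans (divides (+ 2) refl) (Δw-odd≡4[mod8] n m)) (ℤS.∣-refl {+ 4}))
      (restore (Δw n (suc (2 * m))))
      where
      restore : ∀ x → (x - + 4) + + 4 ≡ x
      restore = solve-∀
    q∣Δw : + q ∣ᶻ Δw n (suc (2 * m))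
    q∣Δw = ∣ᶻ-respʳ (ℤS.∣m∣n⇒∣m+n (ℤS.∣n⇒∣m*n ((+ 3) ^ᶻ n) (ℤS.∣ᵤ⇒∣ 3^k≡1))
                                  (ℤS.∣m⇒∣m*n (-1ℤ ^ᶻ n) (ℤS.∣n⇒∣m*n (+ 2) (q∣qstar q))))
      (sym (Δw-odd n m))

3^α*δ≡p⇒α≡0 : ∀ {p} α δ → Prime p → 3 < p → 3 ^ α * δ ≡ p → α ≡ 0
3^α*δ≡p⇒α≡0 zero    _ _  _   _  = refl
3^α*δ≡p⇒α≡0 {p} (suc α) δ pp 3<p eq = contradiction (∣prime⇒≡ pp (s≤s (s≤s z≤n)) 3∣p) (ℕP.<⇒≢ 3<p)
  where
  3∣p : 3 ∣ p
  3∣p = subst (3 ∣_) eq (ℕD.∣-trans (ℕD.m∣m*n (3 ^ α)) (ℕD.m∣m*n δ))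

module Period {q d α δ} (pq : Prime q) (5≤q : 5 ≤ q) (1<d : 1 < d) (d≡3^αδ : d ≡ 3 ^ α * δ) (3∤δ : ¬ 3 ∣ δ) where

  open OddShift pq 5≤q

  d≡q⇒α≡0 : d ≡ q → α ≡ 0
  d≡q⇒α≡0 d≡q = 3^α*δ≡p⇒α≡0 α δ pq 3<q (trans (sym d≡3^αδ) d≡q)

  d≡q⇒δ≡q : d ≡ q → δ ≡ q
  d≡q⇒δ≡q d≡q = trans (sym (ℕP.*-identityˡ δ))
    (subst (λ a → 3 ^ a * δ ≡ q) (d≡q⇒α≡0 d≡q) (trans (sym d≡3^αδ) d≡q))

  admissible⇒4d∣Δw : ∀ {n₀ k} → Admissible v d n₀ k → ∀ n → n₀ ≤ n → + (4 * d) ∣ᶻ Δw n k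
  admissible⇒4d∣Δw {k = k} (_ , adm) n n₀≤n = ≡[mod]⇒4d∣Δw d n k (adm n n₀≤n)

  4d∣Δw⇒admissible : ∀ {n₀ k} → 1 ≤ n₀ → (∀ n → n₀ ≤ n → + (4 * d) ∣ᶻ Δw n k) → Admissible v d n₀ k
  4d∣Δw⇒admissible {k = k} 1≤n₀ 4d∣Δw = 1≤n₀ , λ n n₀≤n → 4d∣Δw⇒≡[mod] d n k (4d∣Δw n n₀≤n)

  admissible-even⇒ : ∀ {n₀} m → Admissible v d n₀ (2 * suc m) → α ≤ n₀ × ((+ 9) ^ᶻ suc m ≡ 1ℤ [mod 4 * δ ])
  admissible-even⇒ {n₀} m adm =
    even-shift⇒ α δ n₀ m 3∤δ (subst (λ x → + (4 * x) ∣ᶻ _) d≡3^αδ (admissible⇒4d∣Δw adm n₀ ℕP.≤-refl))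

  admissible-even⇐ : ∀ {n₀} m → 1 ≤ n₀ → α ≤ n₀ → (+ 9) ^ᶻ m ≡ 1ℤ [mod 4 * δ ] → Admissible v d n₀ (2 * m)
  admissible-even⇐ m 1≤n₀ α≤n₀ 9^m≡1 = 4d∣Δw⇒admissible 1≤n₀ λ n n₀≤n →
    subst (λ x → + (4 * x) ∣ᶻ Δw n (2 * m)) (sym d≡3^αδ) (even-shift⇐ α δ n m (ℕP.≤-trans α≤n₀ n₀≤n) 9^m≡1)

  admissible-odd⇒ : ∀ {n₀} m → Admissible v d n₀ (suc (2 * m)) → d ≡ q × ((+ 3) ^ᶻ suc (2 * m) ≡ 1ℤ [mod q ])
  admissible-odd⇒ {n₀} m adm = d≡q , odd-shift⇒3^k≡1 n₀ m (subst (λ x → + (4 * x) ∣ᶻ _) d≡q 4d∣Δw)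
    where
    4d∣Δw : + (4 * d) ∣ᶻ Δw n₀ (suc (2 * m))
    4d∣Δw = admissible⇒4d∣Δw adm n₀ ℕP.≤-refl
    d≡q : d ≡ q
    d≡q = odd-shift⇒d≡q d n₀ m 1<d 4d∣Δw (admissible⇒4d∣Δw adm (suc n₀) (ℕP.n≤1+n n₀))

  admissible-odd⇐ : ∀ k → ¬ 2 ∣ k → d ≡ q → (+ 3) ^ᶻ k ≡ 1ℤ [mod q ] → Admissible v d 1 k
  admissible-odd⇐ k 2∤k d≡q 3^k≡1 with parity k
  ... | even m = contradiction (ℕD.m∣m*n m) 2∤k
  ... | odd m  = 4d∣Δw⇒admissible ℕP.≤-refl λ n _ →
    subst (λ x → + (4 * x) ∣ᶻ Δw n (suc (2 * m))) (sym d≡q) (odd-shift⇐ n m 3^k≡1)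

  eventually-periodic : EventuallyPeriodic v d
  eventually-periodic =
    let e , 3^[1+e]≡1 = coprime⇒pow≡1 (4 * δ) {{4δ≢0}} cop
    in suc α , 2 * suc e , s≤s z≤n ,
       admissible-even⇐ (suc e) (s≤s z≤n) (ℕP.n≤1+n α) (ℤS.∣⇒∣ᵤ (3^s≡1⇒9^s≡1 (suc e) (ℤS.∣ᵤ⇒∣ {+ (4 * δ)} 3^[1+e]≡1)))
    where
    cop : Coprime (4 * δ) 3
    cop = coprime[4δ,3] 3∤δ
    4δ≢0 : NonZero (4 * δ)
    4δ≢0 = ℕ.≢-nonZero λ 4δ≡0 → ℕC.¬0-coprimeTo-2+ (subst (λ x → Coprime x 3) 4δ≡0 cop)

  ord-is-period : ∀ r s → IsOrd (4 * δ) 9 r → IsOrd q 3 s → (d ≡ q × s % 2 ≡ 1) → IsPeriod v d r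
  ord-is-period r s ord9@(1≤r , _ , least9) ord3 (d≡q , s%2≡1) =
    1≤r , (1 , subst (Admissible v d 1) (sym r≡s) (admissible-odd⇐ s 2∤s d≡q (proj₁ (proj₂ ord3)))) , minimal
    where
    2∤s : ¬ 2 ∣ s
    2∤s = %2≡1⇒¬2∣ s s%2≡1
    r≡s : r ≡ s
    r≡s = ord[4q]9≡ord[q]3 pq 5≤q (subst (λ x → IsOrd (4 * x) 9 r) (d≡q⇒δ≡q d≡q) ord9) ord3 2∤s
    minimal : ∀ k n₀ → 1 ≤ k → Admissible v d n₀ k → r ≤ k
    minimal k n₀ 1≤k adm with parity k
    ... | even zero    = contradiction 1≤k λ ()
    ... | even (suc m) = ℕP.≤-trans (least9 (suc m) (s≤s z≤n) (proj₂ (admissible-even⇒ m adm))) (ℕP.m≤m+n (suc m) _)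
    ... | odd m        = subst (_≤ suc (2 * m)) (sym r≡s) (ℕD.∣⇒≤ (ord∣ ord3 (proj₂ (admissible-odd⇒ m adm))))

  twice-ord-is-period : ∀ r s → IsOrd (4 * δ) 9 r → IsOrd q 3 s → ¬ (d ≡ q × s % 2 ≡ 1) → IsPeriod v d (2 * r)
  twice-ord-is-period r s (1≤r , 9^r≡1 , least9) ord3 ¬[d≡q∧s-odd] =
    ℕP.≤-trans 1≤r (ℕP.m≤m+n r _) , (suc α , admissible-even⇐ r (s≤s z≤n) (ℕP.n≤1+n α) 9^r≡1) , minimal
    where
    minimal : ∀ k n₀ → 1 ≤ k → Admissible v d n₀ k → 2 * r ≤ k
    minimal k n₀ 1≤k adm with parity k
    ... | even zero    = contradiction 1≤k λ ()
    ... | even (suc m) = ℕP.*-monoʳ-≤ 2 (least9 (suc m) (s≤s z≤n) (proj₂ (admissible-even⇒ m adm)))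
    ... | odd m        = contradiction (d≡q , ¬2∣⇒%2≡1 s 2∤s) ¬[d≡q∧s-odd]
      where
      d≡q : d ≡ q
      d≡q = proj₁ (admissible-odd⇒ m adm)
      2∤s : ¬ 2 ∣ s
      2∤s 2∣s = ¬2∣odd m (ℕD.∣-trans 2∣s (ord∣ ord3 (proj₂ (admissible-odd⇒ m adm))))

  pre-period : ∀ ρ → IsPeriod v d ρ → IsPrePeriod v d ρ (1 ⊔ α)
  pre-period ρ (1≤ρ , (n₀ , adm) , _) with parity ρ
  ... | even zero    = contradiction 1≤ρ λ ()
  ... | even (suc m) =
      admissible-even⇐ (suc m) (ℕP.m≤m⊔n 1 α) (ℕP.m≤n⊔m 1 α) (proj₂ (admissible-even⇒ m adm))
    , λ n₁ adm₁ → ℕP.⊔-lub (proj₁ adm₁) (proj₁ (admissible-even⇒ m adm₁))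
  ... | odd m        =
      subst (λ n → Admissible v d n (suc (2 * m))) (sym 1⊔α≡1) (admissible-odd⇐ (suc (2 * m)) (¬2∣odd m) d≡q 3^k≡1)
    , λ n₁ adm₁ → subst (_≤ n₁) (sym 1⊔α≡1) (proj₁ adm₁)
    where
    d≡q : d ≡ q
    d≡q = proj₁ (admissible-odd⇒ m adm)
    3^k≡1 : (+ 3) ^ᶻ suc (2 * m) ≡ 1ℤ [mod q ]
    3^k≡1 = proj₂ (admissible-odd⇒ m adm)
    1⊔α≡1 : 1 ⊔ α ≡ 1
    1⊔α≡1 = cong (1 ⊔_) (d≡q⇒α≡0 d≡q)

theorem3 : (q d α δ : ℕ) → Prime q → 5 ≤ q → 1 < d → d ≡ 3 ^ α * δ → ¬ (3 ∣ δ)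
    → EventuallyPeriodic (u q) d
    × (∀ r s → IsOrd (4 * δ) 9 r → IsOrd q 3 s
         → ((d ≡ q × s % 2 ≡ 1) → IsPeriod (u q) d r)
         × (¬ (d ≡ q × s % 2 ≡ 1) → IsPeriod (u q) d (2 * r)))
    × (∀ ρ → IsPeriod (u q) d ρ → IsPrePeriod (u q) d ρ (1 ⊔ α))
theorem3 q d α δ pq 5≤q 1<d d≡3^αδ 3∤δ =
    eventually-periodic
  , (λ r s ord9 ord3 → ord-is-period r s ord9 ord3 , twice-ord-is-period r s ord9 ord3)
  , pre-period
  where
  open Period {α = α} pq 5≤q 1<d d≡3^αδ 3∤δ
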